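{- For any graph $G$ of order $n\ge 7$ and any $k\in\{1,\ldots,\mathcal{C}(G)\}$, $\operatorname{adim}_k(G)\ge k+2$.
   Context: All graphs are finite and simple. For a graph $G=(V,E)$, $d_{G,2}(x,y)=\min\{d_G(x,y),2\}$ with $d_G$ the shortest-path distance ($\infty$ between different components). For distinct $x,y$, $\mathcal{C}_G(x,y)=\{z\in V: d_{G,2}(x,z)\ne d_{G,2}(y,z)\}$ and $\mathcal{C}(G)=\min_{x\ne y}|\mathcal{C}_G(x,y)|$. A set $S\subseteq V$ is a $k$-adjacency generator if $|S\cap\mathcal{C}_G(x,y)|\ge k$ for all distinct $x,y$; $\operatorname{adim}_k(G)$ is the minimum cardinality of such a set. -}

module Defs where

open import Data.Nat using (ℕ; zero; suc; _≤_)
open import Data.Bool using (Bool; true; false; if_then_else_)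
open import Data.Fin using (Fin; _≟_)
open import Data.Fin.Subset using (Subset; _∩_; ∣_∣)
open import Data.Vec using (tabulate)
open import Relation.Nullary using (¬_; does)
open import Relation.Binary.PropositionalEquality using (_≡_)

record Graph (n : ℕ) : Set where
  field
    adj   : Fin n → Fin n → Bool
    sym   : ∀ x y → adj x y ≡ adj y x
    irref : ∀ x → adj x x ≡ false
open Graph public

-- Truncated distance d_{G,2}(x,y) = min{d_G(x,y),2}:
-- 0 if x = y, 1 if x,y adjacent, 2 otherwise (distance ≥ 2 or ∞).
d2 : ∀ {n} → Graph n → Fin n → Fin n → ℕ
d2 G x y = if does (x ≟ y) then 0 else (if adj G x y then 1 else 2)

distinguishes : ∀ {n} → Graph n → Fin n → Fin n → Fin n → Bool
distinguishes G x y z with d2 G x z Data.Nat.≟ d2 G y z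
... | Relation.Nullary.yes _ = false
... | Relation.Nullary.no  _ = true

CG : ∀ {n} → Graph n → Fin n → Fin n → Subset n
CG G x y = tabulate (distinguishes G x y)

_≤𝒞_ : ∀ {n} → ℕ → Graph n → Set
k ≤𝒞 G = ∀ x y → ¬ x ≡ y → k ≤ ∣ CG G x y ∣

IsKAdjGen : ∀ {n} → Graph n → ℕ → Subset n → Set
IsKAdjGen G k S = ∀ x y → ¬ x ≡ y → k ≤ ∣ S ∩ CG G x y ∣

adim≥ : ∀ {n} → Graph n → ℕ → ℕ → Set
adim≥ G k m = ∀ S → IsKAdjGen G k S → m ≤ ∣ S ∣

-- Two vertices z₁, z₂ split the other vertices into at most four classes by
-- their adjacency to z₁ and z₂, so among at least seven vertices there are
-- two, i and j, outside {z₁, z₂} in the same class; neither z₁ nor z₂ then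
-- distinguishes i from j. If a k-adjacency generator S had two elements z₁, z₂,
-- this gives k ≤ |S ∩ C(i,j)| ≤ |S| − 2. Otherwise |S| ≤ 1, and the same
-- argument with z₁ = z₂ the only element of S gives k ≤ |S| − 1 ≤ 0.
module Submission where

open import Defs hiding (sym)
open import Data.Nat using (ℕ; _≤_; _+_; _<_; s≤s; z≤n; _≤?_)
import Data.Nat as ℕ
open import Data.Nat.Properties
  using (≤-trans; ≤-<-trans; +-monoˡ-≤; +-comm; ≰⇒>; <⇒≱; module ≤-Reasoning)
open import Data.Bool using (Bool; true; false; if_then_else_)
open import Data.Fin using (Fin; zero; suc; _≟_; combine)
open import Data.Fin.Properties using (pigeonhole; suc-injective; <⇒≢; combine-injective; 2↔Bool)
open import Data.Fin.Subset using (Subset; _∩_; ∣_∣; _∈_; _∉_; _⊆_; _-_; Nonempty; inside; outside)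
open import Data.Vec using (_∷_; here; there; lookup)
open import Data.Fin.Subset.Properties
  using (x∈p∩q⁻; x∈p∩q⁺; x∈p∧x≢y⇒x∈p-y; x∈p⇒∣p-x∣<∣p∣; p⊆q⇒∣p∣≤∣q∣; ∣p∩q∣≤∣p∣)
open import Data.Vec.Properties using (lookup∘tabulate; []=⇒lookup)
open import Data.Product using (_×_; _,_; ∃₂)
import Data.Product as Product
open import Function using (case_of_; _∘_)
open import Function.Bundles using (Injection; _↣_)
open import Function.Properties.Inverse using (Inverse⇒Injection; ↔-sym)
open import Relation.Nullary using (yes; no; contradiction)
open import Relation.Binary.PropositionalEquality
  using (_≡_; _≢_; refl; sym; trans; cong; module ≡-Reasoning)

private
  variable
    n m : ℕ

Bool↣Fin2 : Bool ↣ Fin 2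
Bool↣Fin2 = Inverse⇒Injection (↔-sym 2↔Bool)

open Injection Bool↣Fin2 using () renaming (to to bit; injective to bit-injective)

0<∣p∣⇒Nonempty : (p : Subset n) → 0 < ∣ p ∣ → Nonempty p
0<∣p∣⇒Nonempty (inside ∷ p) _ = zero , here
0<∣p∣⇒Nonempty (outside ∷ p) 0<∣p∣ = Product.map suc there (0<∣p∣⇒Nonempty p 0<∣p∣)

1<∣p∣⇒twoElements : (p : Subset n) → 1 < ∣ p ∣ → ∃₂ λ x y → x ≢ y × x ∈ p × y ∈ p
1<∣p∣⇒twoElements (inside ∷ p) (s≤s 0<∣p∣) with y , y∈p ← 0<∣p∣⇒Nonempty p 0<∣p∣ =
  zero , suc y , (λ ()) , here , there y∈p
1<∣p∣⇒twoElements (outside ∷ p) 1<∣p∣ with x , y , x≢y , x∈p , y∈p ← 1<∣p∣⇒twoElements p 1<∣p∣ =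
  suc x , suc y , x≢y ∘ suc-injective , there x∈p , there y∈p

x∉q⇒p∩q⊆[p-x]∩q : {p q : Subset n} {x : Fin n} → x ∉ q → p ∩ q ⊆ (p - x) ∩ q
x∉q⇒p∩q⊆[p-x]∩q {p = p} {q} x∉q y∈p∩q with y∈p , y∈q ← x∈p∩q⁻ p q y∈p∩q =
  x∈p∩q⁺ (x∈p∧x≢y⇒x∈p-y y∈p (λ { refl → x∉q y∈q }) , y∈q)

x∈p∧x∉q⇒∣p∩q∣<∣p∣ : {p q : Subset n} {x : Fin n} → x ∈ p → x ∉ q → ∣ p ∩ q ∣ < ∣ p ∣
x∈p∧x∉q⇒∣p∩q∣<∣p∣ {p = p} {q} {x} x∈p x∉q =
  ≤-<-trans (p⊆q⇒∣p∣≤∣q∣ (x∉q⇒p∩q⊆[p-x]∩q {p = p} x∉q))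
    (≤-<-trans (∣p∩q∣≤∣p∣ (p - x) q) (x∈p⇒∣p-x∣<∣p∣ x∈p))

x,y∈p∧x,y∉q⇒2+∣p∩q∣≤∣p∣ : {p q : Subset n} {x y : Fin n} → x ≢ y →
                          x ∈ p → y ∈ p → x ∉ q → y ∉ q → 2 + ∣ p ∩ q ∣ ≤ ∣ p ∣
x,y∈p∧x,y∉q⇒2+∣p∩q∣≤∣p∣ {p = p} {q} {x} x≢y x∈p y∈p x∉q y∉q = begin-strict
  1 + ∣ p ∩ q ∣       ≤⟨ s≤s (p⊆q⇒∣p∣≤∣q∣ (x∉q⇒p∩q⊆[p-x]∩q {p = p} x∉q)) ⟩
  1 + ∣ (p - x) ∩ q ∣ <⟨ s≤s (x∈p∧x∉q⇒∣p∩q∣<∣p∣ {p = p - x} (x∈p∧x≢y⇒x∈p-y y∈p (x≢y ∘ sym)) y∉q) ⟩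
  1 + ∣ p - x ∣       ≤⟨ x∈p⇒∣p-x∣<∣p∣ x∈p ⟩
  ∣ p ∣               ∎
  where open ≤-Reasoning

flagAt : Fin n → Fin n → Fin m → Fin (ℕ.suc m)
flagAt z v c with v ≟ z
... | yes _ = zero
... | no _  = suc c

flagAt-injective : {z i j : Fin n} {c d : Fin m} → i ≢ j →
                   flagAt z i c ≡ flagAt z j d → i ≢ z × j ≢ z × c ≡ d
flagAt-injective {z = z} {i} {j} i≢j eq with i ≟ z | j ≟ z
... | yes i≡z | yes j≡z = contradiction (trans i≡z (sym j≡z)) i≢j
... | yes _   | no _    = case eq of λ ()
... | no _    | yes _   = case eq of λ ()
... | no i≢z  | no j≢z  = i≢z , j≢z , suc-injective eq

pigeonhole-outside₂ : 2 + m < n → (f : Fin n → Fin m) (z₁ z₂ : Fin n) →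
                      ∃₂ λ i j → i ≢ j × i ≢ z₁ × j ≢ z₁ × i ≢ z₂ × j ≢ z₂ × f i ≡ f j
pigeonhole-outside₂ 2+m<n f z₁ z₂
  with i , j , i<j , eq ← pigeonhole 2+m<n (λ v → flagAt z₁ v (flagAt z₂ v (f v)))
  with i≢z₁ , j≢z₁ , eq′ ← flagAt-injective (<⇒≢ i<j) eq
  with i≢z₂ , j≢z₂ , fi≡fj ← flagAt-injective (<⇒≢ i<j) eq′
  = i , j , <⇒≢ i<j , i≢z₁ , j≢z₁ , i≢z₂ , j≢z₂ , fi≡fj

d2-≢ : (G : Graph n) {x z : Fin n} → x ≢ z → d2 G x z ≡ (if adj G x z then 1 else 2)
d2-≢ G {x} {z} x≢z with x ≟ z
... | yes x≡z = contradiction x≡z x≢z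
... | no _    = refl

sameAdjacency⇒sameDistance : (G : Graph n) {x y z : Fin n} → x ≢ z → y ≢ z →
                             adj G x z ≡ adj G y z → d2 G x z ≡ d2 G y z
sameAdjacency⇒sameDistance G {x} {y} {z} x≢z y≢z same = begin
  d2 G x z                      ≡⟨ d2-≢ G x≢z ⟩
  (if adj G x z then 1 else 2)  ≡⟨ cong (λ b → if b then 1 else 2) same ⟩
  (if adj G y z then 1 else 2)  ≡⟨ sym (d2-≢ G y≢z) ⟩
  d2 G y z                      ∎
  where open ≡-Reasoning

sameDistance⇒¬distinguishes : (G : Graph n) {x y z : Fin n} →
                              d2 G x z ≡ d2 G y z → distinguishes G x y z ≡ false
sameDistance⇒¬distinguishes G {x} {y} {z} same with d2 G x z ℕ.≟ d2 G y z
... | yes _  = refl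
... | no ≢ = contradiction same ≢

sameDistance⇒∉CG : (G : Graph n) {x y z : Fin n} → d2 G x z ≡ d2 G y z → z ∉ CG G x y
sameDistance⇒∉CG G {x} {y} {z} same z∈CG = case true≡false of λ ()
  where
  open ≡-Reasoning
  true≡false : true ≡ false
  true≡false = begin
    true                     ≡⟨ sym ([]=⇒lookup z∈CG) ⟩
    lookup (CG G x y) z      ≡⟨ lookup∘tabulate (distinguishes G x y) z ⟩
    distinguishes G x y z    ≡⟨ sameDistance⇒¬distinguishes G same ⟩
    false                    ∎

adjacencyProfile : Graph n → Fin n → Fin n → Fin n → Fin 4
adjacencyProfile G z₁ z₂ v = combine (bit (adj G v z₁)) (bit (adj G v z₂))

undistinguishedPair : 7 ≤ n → (G : Graph n) (z₁ z₂ : Fin n) →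
                      ∃₂ λ i j → i ≢ j × z₁ ∉ CG G i j × z₂ ∉ CG G i j
undistinguishedPair 7≤n G z₁ z₂
  with i , j , i≢j , i≢z₁ , j≢z₁ , i≢z₂ , j≢z₂ , same ←
         pigeonhole-outside₂ 7≤n (adjacencyProfile G z₁ z₂) z₁ z₂
  with same₁ , same₂ ← combine-injective _ _ _ _ same
  = i , j , i≢j , undistinguished i≢z₁ j≢z₁ same₁ , undistinguished i≢z₂ j≢z₂ same₂
  where
  undistinguished : ∀ {z} → i ≢ z → j ≢ z → bit (adj G i z) ≡ bit (adj G j z) → z ∉ CG G i j
  undistinguished i≢z j≢z same =
    sameDistance⇒∉CG G (sameAdjacency⇒sameDistance G i≢z j≢z (bit-injective same))

IsKAdjGen⇒k≤∣S∣ : {G : Graph n} {k : ℕ} {S : Subset n} → 2 ≤ n → IsKAdjGen G k S → k ≤ ∣ S ∣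
IsKAdjGen⇒k≤∣S∣ {S = S} (s≤s (s≤s _)) gen = ≤-trans (gen zero (suc zero) (λ ())) (∣p∩q∣≤∣p∣ S _)

-- The hypothesis k ≤ 𝒞(G) only guarantees that k-adjacency generators exist.
theorem18 : (n : ℕ) → 7 ≤ n → (G : Graph n) → (k : ℕ) → 1 ≤ k → k ≤𝒞 G →
            adim≥ G k (k + 2)
theorem18 n 7≤n G k 1≤k _ S gen with 2 ≤? ∣ S ∣
... | yes 2≤∣S∣
  with z₁ , z₂ , z₁≢z₂ , z₁∈S , z₂∈S ← 1<∣p∣⇒twoElements S 2≤∣S∣
  with i , j , i≢j , z₁∉C , z₂∉C ← undistinguishedPair 7≤n G z₁ z₂ = begin
    k + 2                  ≤⟨ +-monoˡ-≤ 2 (gen i j i≢j) ⟩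
    ∣ S ∩ CG G i j ∣ + 2   ≡⟨ +-comm _ 2 ⟩
    2 + ∣ S ∩ CG G i j ∣   ≤⟨ x,y∈p∧x,y∉q⇒2+∣p∩q∣≤∣p∣ z₁≢z₂ z₁∈S z₂∈S z₁∉C z₂∉C ⟩
    ∣ S ∣                  ∎
  where open ≤-Reasoning
... | no ∣S∣≱2
  with z , z∈S ← 0<∣p∣⇒Nonempty S (≤-trans 1≤k (IsKAdjGen⇒k≤∣S∣ {S = S} (≤-trans (s≤s (s≤s z≤n)) 7≤n) gen))
  with i , j , i≢j , z∉C , _ ← undistinguishedPair 7≤n G z z =
  contradiction 1≤k (<⇒≱ k<1)
  where
  open ≤-Reasoning
  k<1 : k < 1
  k<1 = begin-strict
    k                  ≤⟨ gen i j i≢j ⟩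
    ∣ S ∩ CG G i j ∣   <⟨ x∈p∧x∉q⇒∣p∩q∣<∣p∣ {p = S} z∈S z∉C ⟩
    ∣ S ∣              ≤⟨ ℕ.≤-pred (≰⇒> ∣S∣≱2) ⟩
    1                  ∎
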